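{- Let $A$ be a set and let $\sqsubseteq^{CS}$ be the order on $\mathcal{P}^A$ given by $u\sqsubseteq^{CS}_X v$ iff for every $a\in A$ either $u(a)=\emptyset$, or ($u(a)\supseteq v(a)$ and $v(a)\neq\emptyset$). Then $\sqsubseteq^{CS}=\prod_{a\in A}\sqsubseteq^{C}$, and $\sqsubseteq^{CS}=\prod_{a\in A}(\sqsubseteq^{C\neg\emptyset}\cup\sqsubseteq^{C\emptyset})^*=\big(\prod_{a\in A}\sqsubseteq^{C\neg\emptyset}\big)\circ\big(\prod_{a\in A}\sqsubseteq^{C\emptyset}\big)=\big(\prod_{a\in A}\sqsubseteq^{C\emptyset}\big)\circ\big(\prod_{a\in A}\sqsubseteq^{C\neg\emptyset}\big)$. Thus $\sqsubseteq^{CS}$ is the composition of two orders on $\mathcal{P}^A$ that commute with each other, one of which is right-stable and the other left-stable.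
   Context: $\mathcal{P}$ is the covariant powerset functor and $\mathcal{P}^A$ is $X\mapsto(\mathcal{P}X)^A$ with $\mathcal{P}^Af(\alpha)(a)=f(\alpha(a))$. On $\mathcal{P}X$: $x_1\sqsubseteq^{C\emptyset}x_2$ iff $x_1=\emptyset$ or $x_1=x_2$; $x_1\sqsubseteq^{C\neg\emptyset}x_2$ iff ($x_1\supseteq x_2$ and $x_2\neq\emptyset$) or $x_1=x_2$; $x_1\sqsubseteq^Cx_2$ iff $x_1\sqsubseteq^{C\neg\emptyset}x_2$ or $x_1\sqsubseteq^{C\emptyset}x_2$. For a family of relations $\sqsubseteq^a$ on $\mathcal{P}X$, $\prod_{a\in A}\sqsubseteq^a$ is the relation on $(\mathcal{P}X)^A$ given by $u\,(\prod_a\sqsubseteq^a)\,v$ iff $u(a)\sqsubseteq^a v(a)$ for all $a$ (here all components are the same relation). Composition: $T\circ S=\{(p,t)\mid\exists q.\,(p,q)\in S,(q,t)\in T\}$; $(\cdot)^*$ is reflexive-transitive closure. An order on a functor $G$ is a family of preorders $\sqsubseteq_X$ on $GX$ with $u\sqsubseteq_X u'\Rightarrow Gf(u)\sqsubseteq_Y Gf(u')$. Right-stable: for every $f:X\to Y$, $u\in GX$, $v\in GY$ with $v\sqsubseteq_Y Gf(u)$ there is $u'$ with $Gf(u')=v$ and $u'\sqsubseteq_X u$. Left-stable: for every $f$, $u$, $v$ with $Gf(u)\sqsubseteq_Y v$ there is $u'$ with $u\sqsubseteq_X u'$ and $Gf(u')=v$. Two orders commute if $\sqsubseteq^1_X\circ\sqsubseteq^2_X=\sqsubseteq^2_X\circ\sqsubseteq^1_X$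 for all $X$. -}

module Defs where

open import Level using (0ℓ)
open import Data.Product using (Σ; ∃; _×_; _,_)
open import Data.Sum using (_⊎_)
open import Relation.Nullary using (¬_)
open import Relation.Unary using (Pred; _∈_; _⊆_; _≐_; ∅)
open import Relation.Binary.Core using (Rel)
open import Relation.Binary.Structures using (IsPreorder)
open import Relation.Binary.PropositionalEquality using (_≡_)
open import Relation.Binary.Construct.Closure.ReflexiveTransitive using (Star)

-- Covariant powerset functor: subsets as predicates, compared by _≐_
𝒫 : Set → Set₁
𝒫 X = Pred X 0ℓ

𝒫map : {X Y : Set} → (X → Y) → 𝒫 X → 𝒫 Y
𝒫map f S = λ y → ∃ λ x → x ∈ S × f x ≡ y

𝒫^ : Set → Set → Set₁
𝒫^ A X = A → 𝒫 X

𝒫^map : {A X Y : Set} → (X → Y) → 𝒫^ A X → 𝒫^ A Y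
𝒫^map f α = λ a → 𝒫map f (α a)

_≈ᴬ_ : {A X : Set} → Rel (𝒫^ A X) 0ℓ
u ≈ᴬ v = ∀ a → u a ≐ v a

⊑C∅ : {X : Set} → Rel (𝒫 X) 0ℓ
⊑C∅ x₁ x₂ = (x₁ ≐ ∅) ⊎ (x₁ ≐ x₂)

⊑C¬∅ : {X : Set} → Rel (𝒫 X) 0ℓ
⊑C¬∅ x₁ x₂ = ((x₂ ⊆ x₁) × ¬ (x₂ ≐ ∅)) ⊎ (x₁ ≐ x₂)

_∪ᴿ_ : {B : Set₁} → Rel B 0ℓ → Rel B 0ℓ → Rel B 0ℓ
(R ∪ᴿ S) x y = R x y ⊎ S x y

⊑C : {X : Set} → Rel (𝒫 X) 0ℓ
⊑C = ⊑C¬∅ ∪ᴿ ⊑C∅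

∏ : {A X : Set} {ℓ : Level.Level} → Rel (𝒫 X) ℓ → Rel (𝒫^ A X) ℓ
∏ R u v = ∀ a → R (u a) (v a)

_∘ᴿ_ : {B : Set₁} → Rel B 0ℓ → Rel B 0ℓ → Rel B (Level.suc 0ℓ)
(T ∘ᴿ S) p t = Σ _ λ q → S p q × T q t

_* : {B : Set₁} → Rel B 0ℓ → Rel B (Level.suc 0ℓ)
R * = Star R

_≡ᴿ_ : {B : Set₁} {ℓ₁ ℓ₂ : Level.Level} → Rel B ℓ₁ → Rel B ℓ₂ → Set (Level.suc 0ℓ Level.⊔ ℓ₁ Level.⊔ ℓ₂)
R ≡ᴿ S = ∀ x y → (R x y → S x y) × (S x y → R x y)

⊑CS : {A X : Set} → Rel (𝒫^ A X) 0ℓ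
⊑CS u v = ∀ a → (u a ≐ ∅) ⊎ ((v a ⊆ u a) × ¬ (v a ≐ ∅))

OrdFam : Set → Set₁
OrdFam A = (X : Set) → Rel (𝒫^ A X) 0ℓ

IsOrder : {A : Set} → OrdFam A → Set₁
IsOrder {A} R =
  ((X : Set) → IsPreorder (_≈ᴬ_ {A} {X}) (R X)) ×
  ({X Y : Set} (f : X → Y) (u u' : 𝒫^ A X) → R X u u' → R Y (𝒫^map f u) (𝒫^map f u'))

Commute : {A : Set} → OrdFam A → OrdFam A → Set₁
Commute R₁ R₂ = (X : Set) → (R₁ X ∘ᴿ R₂ X) ≡ᴿ (R₂ X ∘ᴿ R₁ X)

RightStable : {A : Set} → OrdFam A → Set₁
RightStable {A} R = {X Y : Set} (f : X → Y) (u : 𝒫^ A X) (v : 𝒫^ A Y) →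
  R Y v (𝒫^map f u) → Σ (𝒫^ A X) λ u' → (𝒫^map f u' ≈ᴬ v) × R X u' u

LeftStable : {A : Set} → OrdFam A → Set₁
LeftStable {A} R = {X Y : Set} (f : X → Y) (u : 𝒫^ A X) (v : 𝒫^ A Y) →
  R Y (𝒫^map f u) v → Σ (𝒫^ A X) λ u' → R X u u' × (𝒫^map f u' ≈ᴬ v)

-- Componentwise, ⊑CS (x = ∅, or y ⊆ x with y ≠ ∅) is contained in ⊑C, and ⊑C* is contained
-- in ⊑CS: a ⊑C-step followed by a ⊑CS-step is a ⊑CS-step, and ⊑CS is reflexive, which is the
-- one place excluded middle is needed (to decide whether x is empty).  Both composites of the
-- reflexive relations ⊑C¬∅ and ⊑C∅ lie between ⊑C and ⊑C*, so all of them equal ⊑CS, and hence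
-- commute.  The stability witnesses are ∅ or u itself for ⊑C∅, and u ∩ f⁻¹(v) or u for ⊑C¬∅.
{-# OPTIONS --safe #-}
module Submission where

open import Defs
open import Level using (Level; 0ℓ)
open import Data.Empty using (⊥-elim)
open import Data.Product using (Σ; _×_; _,_; proj₁; proj₂; swap)
import Data.Product as Product
open import Data.Sum using (_⊎_; inj₁; inj₂)
import Data.Sum as Sum
open import Function using (id)
open import Relation.Nullary using (¬_; yes; no)
open import Relation.Unary using (_⊆_; _≐_; ∅; _∩_; _⊢_)
open import Relation.Unary.Properties using (≐-refl; ≐-sym; ≐-trans)
open import Relation.Unary.Relation.Binary.Equality using (≐-isEquivalence)
open import Relation.Binary.Core using (Rel; _⇒_; _=[_]⇒_)
open import Relation.Binary.Definitions using (Reflexive; Transitive; Trans)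
open import Relation.Binary.Structures using (IsPreorder)
open import Relation.Binary.PropositionalEquality using (refl)
open import Relation.Binary.Construct.Closure.ReflexiveTransitive
  using (Star; ε; _◅_; fold; return)
open import Axiom.ExcludedMiddle using (ExcludedMiddle)

private
  variable
    A X Y : Set
    B : Set₁
    ℓ₁ ℓ₂ ℓ₃ : Level

mk≡ᴿ : {R : Rel B ℓ₁} {S : Rel B ℓ₂} → R ⇒ S → S ⇒ R → R ≡ᴿ S
mk≡ᴿ R⇒S S⇒R _ _ = R⇒S , S⇒R

≡ᴿ-sym : {R : Rel B ℓ₁} {S : Rel B ℓ₂} → R ≡ᴿ S → S ≡ᴿ R
≡ᴿ-sym R≡S x y = swap (R≡S x y)

≡ᴿ-trans : {R : Rel B ℓ₁} {S : Rel B ℓ₂} {T : Rel B ℓ₃} → R ≡ᴿ S → S ≡ᴿ T → R ≡ᴿ T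
≡ᴿ-trans R≡S S≡T x y =
  (λ r → proj₁ (S≡T x y) (proj₁ (R≡S x y) r)) , (λ t → proj₂ (R≡S x y) (proj₂ (S≡T x y) t))

∪ᴿ⇒∘ᴿ : {R S : Rel B 0ℓ} → Reflexive R → Reflexive S → (R ∪ᴿ S) ⇒ (R ∘ᴿ S)
∪ᴿ⇒∘ᴿ _      S-refl (inj₁ r) = _ , S-refl , r
∪ᴿ⇒∘ᴿ R-refl _      (inj₂ s) = _ , s , R-refl

∘ᴿ⇒Star : {S T U : Rel B 0ℓ} → S ⇒ U → T ⇒ U → (T ∘ᴿ S) ⇒ Star U
∘ᴿ⇒Star S⇒U T⇒U (_ , s , t) = S⇒U s ◅ T⇒U t ◅ ε

∀-distrib-Σ× : {I : Set} {P Q : I → B → Set ℓ₁} →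
  (∀ i → Σ B λ b → P i b × Q i b) → Σ (I → B) λ g → (∀ i → P i (g i)) × (∀ i → Q i (g i))
∀-distrib-Σ× h = (λ i → proj₁ (h i)) , (λ i → proj₁ (proj₂ (h i))) , (λ i → proj₂ (proj₂ (h i)))

∏-cong : {R : Rel (𝒫 X) ℓ₁} {S : Rel (𝒫 X) ℓ₂} → R ≡ᴿ S → ∏ {A} R ≡ᴿ ∏ S
∏-cong R≡S u v =
  (λ r a → proj₁ (R≡S (u a) (v a)) (r a)) , (λ s a → proj₂ (R≡S (u a) (v a)) (s a))

∏-∘ᴿ : {S T : Rel (𝒫 X) 0ℓ} → ∏ {A} (T ∘ᴿ S) ≡ᴿ (∏ T ∘ᴿ ∏ S)
∏-∘ᴿ = mk≡ᴿ ∀-distrib-Σ× (λ { (_ , s , t) a → _ , s a , t a })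

∏-isOrder : {R : {X : Set} → Rel (𝒫 X) 0ℓ} →
  (∀ {X} → IsPreorder _≐_ (R {X})) → (∀ {X Y} (f : X → Y) → R =[ 𝒫map f ]⇒ R) →
  IsOrder {A} (λ X → ∏ R)
∏-isOrder R-isPreorder R-𝒫map =
    (λ X → record
      { isEquivalence = record
          { refl  = λ _ → ≐-refl
          ; sym   = λ e a → ≐-sym (e a)
          ; trans = λ e e′ a → ≐-trans (e a) (e′ a)
          }
      ; reflexive = λ e a → IsPreorder.reflexive R-isPreorder (e a)
      ; trans = λ r r′ a → IsPreorder.trans R-isPreorder (r a) (r′ a)
      })
  , λ f _ _ r a → R-𝒫map f (r a)

⊆∅⇒≐∅ : {x : 𝒫 X} → x ⊆ ∅ → x ≐ ∅
⊆∅⇒≐∅ x⊆∅ = x⊆∅ , λ ()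

≢∅-resp-≐ : {x y : 𝒫 X} → x ≐ y → ¬ (x ≐ ∅) → ¬ (y ≐ ∅)
≢∅-resp-≐ x≐y x≢∅ y≐∅ = x≢∅ (≐-trans x≐y y≐∅)

module _ (f : X → Y) where

  𝒫map-mono : {x y : 𝒫 X} → x ⊆ y → 𝒫map f x ⊆ 𝒫map f y
  𝒫map-mono x⊆y (a , a∈x , fa≡b) = a , x⊆y a∈x , fa≡b

  𝒫map-cong : {x y : 𝒫 X} → x ≐ y → 𝒫map f x ≐ 𝒫map f y
  𝒫map-cong (x⊆y , y⊆x) = 𝒫map-mono x⊆y , 𝒫map-mono y⊆x

  𝒫map-≐∅ : {x : 𝒫 X} → x ≐ ∅ → 𝒫map f x ≐ ∅
  𝒫map-≐∅ (x⊆∅ , _) = ⊆∅⇒≐∅ λ { (_ , a∈x , _) → x⊆∅ a∈x }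

  𝒫map-≢∅ : {x : 𝒫 X} → ¬ (x ≐ ∅) → ¬ (𝒫map f x ≐ ∅)
  𝒫map-≢∅ x≢∅ (fx⊆∅ , _) = x≢∅ (⊆∅⇒≐∅ λ a∈x → fx⊆∅ (_ , a∈x , refl))

  𝒫map-∩-⊢ : {x : 𝒫 X} {y : 𝒫 Y} → y ⊆ 𝒫map f x → 𝒫map f (x ∩ f ⊢ y) ≐ y
  𝒫map-∩-⊢ {x} {y} y⊆fx = (λ { (_ , (_ , fa∈y) , refl) → fa∈y }) , y⊆image
    where
    y⊆image : y ⊆ 𝒫map f (x ∩ f ⊢ y)
    y⊆image b∈y with y⊆fx b∈y
    ... | a , a∈x , refl = a , (a∈x , b∈y) , refl

⊑C¬∅-trans : Transitive (⊑C¬∅ {X})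
⊑C¬∅-trans (inj₁ (y⊆x , y≢∅)) (inj₁ (z⊆y , z≢∅)) = inj₁ ((λ c∈z → y⊆x (z⊆y c∈z)) , z≢∅)
⊑C¬∅-trans (inj₁ (y⊆x , y≢∅)) (inj₂ y≐z)         =
  inj₁ ((λ c∈z → y⊆x (proj₂ y≐z c∈z)) , ≢∅-resp-≐ y≐z y≢∅)
⊑C¬∅-trans (inj₂ x≐y)         (inj₁ (z⊆y , z≢∅)) = inj₁ ((λ c∈z → proj₂ x≐y (z⊆y c∈z)) , z≢∅)
⊑C¬∅-trans (inj₂ x≐y)         (inj₂ y≐z)         = inj₂ (≐-trans x≐y y≐z)

⊑C∅-trans : Transitive (⊑C∅ {X})
⊑C∅-trans (inj₁ x≐∅) _          = inj₁ x≐∅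
⊑C∅-trans (inj₂ x≐y) (inj₁ y≐∅) = inj₁ (≐-trans x≐y y≐∅)
⊑C∅-trans (inj₂ x≐y) (inj₂ y≐z) = inj₂ (≐-trans x≐y y≐z)

⊑C¬∅-isPreorder : IsPreorder _≐_ (⊑C¬∅ {X})
⊑C¬∅-isPreorder =
  record { isEquivalence = ≐-isEquivalence ; reflexive = inj₂ ; trans = ⊑C¬∅-trans }

⊑C∅-isPreorder : IsPreorder _≐_ (⊑C∅ {X})
⊑C∅-isPreorder =
  record { isEquivalence = ≐-isEquivalence ; reflexive = inj₂ ; trans = ⊑C∅-trans }

⊑C¬∅-𝒫map : (f : X → Y) → ⊑C¬∅ =[ 𝒫map f ]⇒ ⊑C¬∅
⊑C¬∅-𝒫map f = Sum.map (Product.map (𝒫map-mono f) (𝒫map-≢∅ f)) (𝒫map-cong f)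

⊑C∅-𝒫map : (f : X → Y) → ⊑C∅ =[ 𝒫map f ]⇒ ⊑C∅
⊑C∅-𝒫map f = Sum.map (𝒫map-≐∅ f) (𝒫map-cong f)

𝒫LeftStable : ({X : Set} → Rel (𝒫 X) 0ℓ) → Set₁
𝒫LeftStable R = ∀ {X Y} (f : X → Y) {x : 𝒫 X} {y : 𝒫 Y} →
  R (𝒫map f x) y → Σ (𝒫 X) λ x′ → R x x′ × 𝒫map f x′ ≐ y

𝒫RightStable : ({X : Set} → Rel (𝒫 X) 0ℓ) → Set₁
𝒫RightStable R = ∀ {X Y} (f : X → Y) {x : 𝒫 X} {y : 𝒫 Y} →
  R y (𝒫map f x) → Σ (𝒫 X) λ x′ → 𝒫map f x′ ≐ y × R x′ x

∏-leftStable : {R : {X : Set} → Rel (𝒫 X) 0ℓ} → 𝒫LeftStable R → LeftStable {A} (λ X → ∏ R)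
∏-leftStable stable f u v fu⊑v = ∀-distrib-Σ× λ a → stable f (fu⊑v a)

∏-rightStable : {R : {X : Set} → Rel (𝒫 X) 0ℓ} → 𝒫RightStable R → RightStable {A} (λ X → ∏ R)
∏-rightStable stable f u v v⊑fu = ∀-distrib-Σ× λ a → stable f (v⊑fu a)

⊑C¬∅-leftStable : 𝒫LeftStable ⊑C¬∅
⊑C¬∅-leftStable f {x}     (inj₂ fx≐y)         = x , inj₂ ≐-refl , fx≐y
⊑C¬∅-leftStable f {x} {y} (inj₁ (y⊆fx , y≢∅)) =
  x ∩ f ⊢ y , inj₁ (proj₁ , x′≢∅) , image≐y
  where
  image≐y : 𝒫map f (x ∩ f ⊢ y) ≐ y
  image≐y = 𝒫map-∩-⊢ f y⊆fx
  x′≢∅ : ¬ (x ∩ f ⊢ y ≐ ∅)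
  x′≢∅ x′≐∅ = y≢∅ (≐-trans (≐-sym image≐y) (𝒫map-≐∅ f x′≐∅))

⊑C∅-rightStable : 𝒫RightStable ⊑C∅
⊑C∅-rightStable f     (inj₁ y≐∅)  = ∅ , ≐-trans (𝒫map-≐∅ f ≐-refl) (≐-sym y≐∅) , inj₁ ≐-refl
⊑C∅-rightStable f {x} (inj₂ y≐fx) = x , ≐-sym y≐fx , inj₂ ≐-refl

-- ⊑CS u v unfolds to ∀ a → ⊑CS₁ (u a) (v a).
⊑CS₁ : Rel (𝒫 X) 0ℓ
⊑CS₁ x y = (x ≐ ∅) ⊎ ((y ⊆ x) × ¬ (y ≐ ∅))

⊑CS₁-refl : ExcludedMiddle 0ℓ → Reflexive (⊑CS₁ {X})
⊑CS₁-refl em {x} with em {x ≐ ∅}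
... | yes x≐∅ = inj₁ x≐∅
... | no  x≢∅ = inj₂ (id , x≢∅)

⊑CS₁-respˡ-≐ : {x y z : 𝒫 X} → x ≐ y → ⊑CS₁ y z → ⊑CS₁ x z
⊑CS₁-respˡ-≐ x≐y (inj₁ y≐∅)         = inj₁ (≐-trans x≐y y≐∅)
⊑CS₁-respˡ-≐ x≐y (inj₂ (z⊆y , z≢∅)) = inj₂ ((λ c∈z → proj₂ x≐y (z⊆y c∈z)) , z≢∅)

⊑C-⊑CS₁-trans : Trans (⊑C {X}) ⊑CS₁ ⊑CS₁
⊑C-⊑CS₁-trans (inj₁ (inj₁ (_ , y≢∅))) (inj₁ y≐∅)         = ⊥-elim (y≢∅ y≐∅)
⊑C-⊑CS₁-trans (inj₁ (inj₁ (y⊆x , _))) (inj₂ (z⊆y , z≢∅)) =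
  inj₂ ((λ c∈z → y⊆x (z⊆y c∈z)) , z≢∅)
⊑C-⊑CS₁-trans (inj₁ (inj₂ x≐y))       y⊑z                = ⊑CS₁-respˡ-≐ x≐y y⊑z
⊑C-⊑CS₁-trans (inj₂ (inj₁ x≐∅))       _                  = inj₁ x≐∅
⊑C-⊑CS₁-trans (inj₂ (inj₂ x≐y))       y⊑z                = ⊑CS₁-respˡ-≐ x≐y y⊑z

⊑CS₁⇒⊑C : ⊑CS₁ {X} ⇒ ⊑C
⊑CS₁⇒⊑C (inj₁ x≐∅)  = inj₂ (inj₁ x≐∅)
⊑CS₁⇒⊑C (inj₂ y⊏x) = inj₁ (inj₁ y⊏x)

Star⊑C⇒⊑CS₁ : ExcludedMiddle 0ℓ → (⊑C {X} *) ⇒ ⊑CS₁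
Star⊑C⇒⊑CS₁ em = fold ⊑CS₁ ⊑C-⊑CS₁-trans (⊑CS₁-refl em)

⊑CS₁-≡ᴿ : ExcludedMiddle 0ℓ → {R : Rel (𝒫 X) ℓ₁} → ⊑C ⇒ R → R ⇒ (⊑C *) → ⊑CS₁ ≡ᴿ R
⊑CS₁-≡ᴿ em ⊑C⇒R R⇒⊑C* =
  mk≡ᴿ (λ r → ⊑C⇒R (⊑CS₁⇒⊑C r)) (λ r → Star⊑C⇒⊑CS₁ em (R⇒⊑C* r))

⊑CS₁≡ᴿ⊑C¬∅∘⊑C∅ : ExcludedMiddle 0ℓ → ⊑CS₁ {X} ≡ᴿ (⊑C¬∅ ∘ᴿ ⊑C∅)
⊑CS₁≡ᴿ⊑C¬∅∘⊑C∅ em = ⊑CS₁-≡ᴿ em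
  (∪ᴿ⇒∘ᴿ {R = ⊑C¬∅} {S = ⊑C∅} (inj₂ ≐-refl) (inj₂ ≐-refl))
  (∘ᴿ⇒Star {S = ⊑C∅} {T = ⊑C¬∅} inj₂ inj₁)

⊑CS₁≡ᴿ⊑C∅∘⊑C¬∅ : ExcludedMiddle 0ℓ → ⊑CS₁ {X} ≡ᴿ (⊑C∅ ∘ᴿ ⊑C¬∅)
⊑CS₁≡ᴿ⊑C∅∘⊑C¬∅ em = ⊑CS₁-≡ᴿ em
  (λ r → ∪ᴿ⇒∘ᴿ {R = ⊑C∅} {S = ⊑C¬∅} (inj₂ ≐-refl) (inj₂ ≐-refl) (Sum.swap r))
  (∘ᴿ⇒Star {S = ⊑C¬∅} {T = ⊑C∅} inj₁ inj₂)

corollary5 : ExcludedMiddle 0ℓ → (A : Set) →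
    ((X : Set) → ⊑CS {A} {X} ≡ᴿ ∏ ⊑C) ×
    ((X : Set) → ⊑CS {A} {X} ≡ᴿ ∏ ((⊑C¬∅ ∪ᴿ ⊑C∅) *)) ×
    ((X : Set) → ⊑CS {A} {X} ≡ᴿ (∏ ⊑C¬∅ ∘ᴿ ∏ ⊑C∅)) ×
    ((X : Set) → ⊑CS {A} {X} ≡ᴿ (∏ ⊑C∅ ∘ᴿ ∏ ⊑C¬∅)) ×
    IsOrder {A} (λ X → ∏ ⊑C¬∅) ×
    IsOrder {A} (λ X → ∏ ⊑C∅) ×
    Commute {A} (λ X → ∏ ⊑C¬∅) (λ X → ∏ ⊑C∅) ×
    LeftStable {A} (λ X → ∏ ⊑C¬∅) ×
    RightStable {A} (λ X → ∏ ⊑C∅)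
corollary5 em A =
    (λ X → ∏-cong (⊑CS₁-≡ᴿ em id return))
  , (λ X → ∏-cong (⊑CS₁-≡ᴿ em return id))
  , ⊑CS≡ᴿ∏⊑C¬∅∘∏⊑C∅
  , ⊑CS≡ᴿ∏⊑C∅∘∏⊑C¬∅
  , ∏-isOrder ⊑C¬∅-isPreorder ⊑C¬∅-𝒫map
  , ∏-isOrder ⊑C∅-isPreorder ⊑C∅-𝒫map
  , (λ X → ≡ᴿ-trans (≡ᴿ-sym (⊑CS≡ᴿ∏⊑C¬∅∘∏⊑C∅ X)) (⊑CS≡ᴿ∏⊑C∅∘∏⊑C¬∅ X))
  , ∏-leftStable ⊑C¬∅-leftStable
  , ∏-rightStable ⊑C∅-rightStable
  where
  ⊑CS≡ᴿ∏⊑C¬∅∘∏⊑C∅ : (X : Set) → ⊑CS {A} {X} ≡ᴿ (∏ ⊑C¬∅ ∘ᴿ ∏ ⊑C∅)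
  ⊑CS≡ᴿ∏⊑C¬∅∘∏⊑C∅ X =
    ≡ᴿ-trans (∏-cong (⊑CS₁≡ᴿ⊑C¬∅∘⊑C∅ em)) (∏-∘ᴿ {S = ⊑C∅} {T = ⊑C¬∅})

  ⊑CS≡ᴿ∏⊑C∅∘∏⊑C¬∅ : (X : Set) → ⊑CS {A} {X} ≡ᴿ (∏ ⊑C∅ ∘ᴿ ∏ ⊑C¬∅)
  ⊑CS≡ᴿ∏⊑C∅∘∏⊑C¬∅ X =
    ≡ᴿ-trans (∏-cong (⊑CS₁≡ᴿ⊑C∅∘⊑C¬∅ em)) (∏-∘ᴿ {S = ⊑C¬∅} {T = ⊑C∅})
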